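{- Let $G$ be a 2-connected graph and let $B$ be a spanning tree of $G$ whose fundamental graph $S_B$ has diameter $d$. Then for any two edges of $B$ there is a sequence of $O(d)$ basis exchange steps, starting from any labelling $(B,l)$, that results in the labelled spanning tree $(B,l')$ where $l'$ is obtained from $l$ by swapping the labels of those two edges and leaving all other labels unchanged.
   Context: A labelled spanning tree of a graph $G$ is a pair $(B,l)$ with $B$ the edge set of a spanning tree and $l$ a bijection from $B$ to $\{1,\ldots,|B|\}$. A basis exchange step removes an edge $e\in B$ and adds an edge $e'\notin B$ such that $(B\setminus\{e\})\cup\{e'\}$ is a spanning tree; $e'$ receives the label $l(e)$ and other labels are unchanged. The fundamental graph $S_B$ of a spanning tree $B$ is the bipartite graph whose vertices are the edges of $G$, with an edge between $e\in B$ and $f\in E(G)\setminus B$ whenever $(B\setminus\{e\})\cup\{f\}$ is a spanning tree (equivalently, $e$ lies on the unique cycle of $B\cup\{f\}$). -}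

module Defs where

open import Data.Nat using (ℕ; zero; suc; _≤_; _*_)
open import Data.Fin using (Fin; _≟_)
open import Data.Product using (Σ; _×_)
open import Data.Sum using (_⊎_)
open import Data.Bool using (if_then_else_)
open import Relation.Nullary using (¬_; does)
open import Relation.Binary.PropositionalEquality using (_≡_; _≢_)

record Graph (n m : ℕ) : Set where
  field
    src tgt  : Fin m → Fin n
    loopless : ∀ e → src e ≢ tgt e
open Graph public

EdgeSet : ℕ → Set₁
EdgeSet m = Fin m → Set

AllEdges : ∀ {m} → EdgeSet m
AllEdges _ = Data.Unit.⊤
  where import Data.Unit

Minus : ∀ {m} → EdgeSet m → Fin m → EdgeSet m
Minus S e x = S x × x ≢ e

Exch : ∀ {m} → EdgeSet m → Fin m → Fin m → EdgeSet m
Exch S e f x = (S x × x ≢ e) ⊎ x ≡ f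

Joins : ∀ {n m} → Graph n m → Fin m → Fin n → Fin n → Set
Joins G e u v = (src G e ≡ u × tgt G e ≡ v) ⊎ (src G e ≡ v × tgt G e ≡ u)

data Reach {n m} (G : Graph n m) (S : EdgeSet m) : Fin n → Fin n → Set where
  here : ∀ {u} → Reach G S u u
  step : ∀ {u w v} (e : Fin m) → S e → Joins G e u w → Reach G S w v → Reach G S u v

Connected : ∀ {n m} → Graph n m → EdgeSet m → Set
Connected G S = ∀ u v → Reach G S u v

-- (V(G), S) has no cycle: no edge e of S lies on a cycle of S, i.e. the
-- ends of e are not joined by a walk in S \ {e}
Acyclic : ∀ {n m} → Graph n m → EdgeSet m → Set
Acyclic G S = ∀ e → S e → ¬ Reach G (Minus S e) (src G e) (tgt G e)

SpanningTree : ∀ {n m} → Graph n m → EdgeSet m → Set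
SpanningTree G S = Connected G S × Acyclic G S

Avoid : ∀ {n m} → Graph n m → Fin n → EdgeSet m
Avoid G x e = src G e ≢ x × tgt G e ≢ x

TwoConnected : ∀ {n m} → Graph n m → Set
TwoConnected {n} G =
  (3 ≤ n) × Connected G AllEdges ×
  (∀ x u v → u ≢ x → v ≢ x → Reach G (Avoid G x) u v)

-- adjacency in the fundamental graph S_B (vertices = edges of G)
FAdj : ∀ {n m} → Graph n m → EdgeSet m → Fin m → Fin m → Set
FAdj G B e f =
  (B e × ¬ B f × SpanningTree G (Exch B e f)) ⊎
  (B f × ¬ B e × SpanningTree G (Exch B f e))

data FWalk {n m} (G : Graph n m) (B : EdgeSet m) : ℕ → Fin m → Fin m → Set where
  here : ∀ {e} → FWalk G B zero e e
  step : ∀ {l e g f} → FAdj G B e g → FWalk G B l g f → FWalk G B (suc l) e f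

Diameter : ∀ {n m} → Graph n m → EdgeSet m → ℕ → Set
Diameter {m = m} G B d =
  (∀ e f → Σ ℕ λ l → l ≤ d × FWalk G B l e f) ×
  Σ (Fin m) λ e → Σ (Fin m) λ f → ∀ l → FWalk G B l e f → d ≤ l

-- A labelling of a spanning tree B with labels {1..k} is encoded by its inverse
-- L : Fin k → Fin m (label i ↦ edge carrying label i); L injective with image B.
Img : ∀ {k m} → (Fin k → Fin m) → EdgeSet m
Img {k} L x = Σ (Fin k) λ i → L i ≡ x

ExStep : ∀ {n m k} → Graph n m → (Fin k → Fin m) → (Fin k → Fin m) → Set
ExStep {m = m} {k} G L L' =
  Σ (Fin k) λ i → Σ (Fin m) λ e' →
    ¬ Img L e' × L' i ≡ e' × (∀ j → j ≢ i → L' j ≡ L j) × SpanningTree G (Img L')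

data ExSteps {n m k} (G : Graph n m) : ℕ → (Fin k → Fin m) → (Fin k → Fin m) → Set where
  done : ∀ {L L'} → (∀ i → L i ≡ L' i) → ExSteps G zero L L'
  more : ∀ {s L M N} → ExStep G L M → ExSteps G s M N → ExSteps G (suc s) L N

SwapLabels : ∀ {k m} → (Fin k → Fin m) → Fin m → Fin m → (Fin k → Fin m)
SwapLabels L e f t =
  if does (L t ≟ e) then f else (if does (L t ≟ f) then e else L t)

-- Two tree edges e and a with a common neighbour g ∉ B in the fundamental
-- graph can trade labels in three exchange steps: B → B - e + g → B - a + g → B
-- moves label(e) to a and label(a) to e.  Since S_B is bipartite, a walk of
-- length l ≤ d from e to f in S_B passes through tree edges e = a₀, a₁, …, a_r = f
-- with 2r = l.  Swapping e and a₁ by one rotation, then a₁ and f recursively,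
-- then e and a₁ again realises the transposition (e f) = (e a₁)(a₁ f)(e a₁),
-- at a cost of at most 3 exchange steps per edge of the walk.
module Submission where

open import Defs
open import Data.Nat using (ℕ; suc; _≤_; _*_; _+_; z≤n; s≤s)
open import Data.Nat.Properties
  using (≤-trans; *-monoʳ-≤; +-monoʳ-≤; *-distribˡ-+; +-comm; m≤n+m; module ≤-Reasoning)
open import Data.Fin using (Fin; _≟_)
open import Data.Product using (Σ; _×_; _,_; proj₂; map₁)
open import Data.Sum using (inj₁; inj₂)
open import Data.Bool using (if_then_else_)
open import Function using (_∘_; _⇔_; Equivalence)
open import Function.Definitions using (Injective)
open import Relation.Nullary using (¬_; does; yes; no; contradiction)
open import Relation.Unary using (_⊆_; _≐_)
open import Relation.Unary.Properties using (≐-sym; ≐-trans)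
open import Relation.Binary.PropositionalEquality
  using (_≡_; _≢_; _≗_; refl; sym; trans; cong; cong₂; subst; module ≡-Reasoning)

-- SwapLabels L e f is definitionally swap e f ∘ L.
swap : ∀ {m} → Fin m → Fin m → Fin m → Fin m
swap a b x = if does (x ≟ a) then b else (if does (x ≟ b) then a else x)

module _ {m : ℕ} where

  swap-ˡ : (a b : Fin m) → swap a b a ≡ b
  swap-ˡ a b with a ≟ a
  ... | yes _   = refl
  ... | no a≢a = contradiction refl a≢a

  swap-ʳ : (a b : Fin m) → swap a b b ≡ a
  swap-ʳ a b with b ≟ a
  ... | yes b≡a = b≡a
  ... | no _ with b ≟ b
  ...   | yes _   = refl
  ...   | no b≢b = contradiction refl b≢b

  swap-fix : {a b x : Fin m} → x ≢ a → x ≢ b → swap a b x ≡ x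
  swap-fix {a} {b} {x} x≢a x≢b with x ≟ a
  ... | yes x≡a = contradiction x≡a x≢a
  ... | no _ with x ≟ b
  ...   | yes x≡b = contradiction x≡b x≢b
  ...   | no _    = refl

  swap-self : (a x : Fin m) → swap a a x ≡ x
  swap-self a x with x ≟ a
  ... | yes x≡a = sym x≡a
  ... | no _    = refl

  data SwapView (a b : Fin m) : Fin m → Set where
    left  : SwapView a b a
    right : SwapView a b b
    other : ∀ {x} → x ≢ a → x ≢ b → SwapView a b x

  swapView : (a b x : Fin m) → SwapView a b x
  swapView a b x with x ≟ a | x ≟ b
  ... | yes refl | _        = left
  ... | no _     | yes refl = right
  ... | no x≢a   | no x≢b   = other x≢a x≢b

  swap-involutive : (a b x : Fin m) → swap a b (swap a b x) ≡ x
  swap-involutive a b x with swapView a b x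
  ... | left          = trans (cong (swap a b) (swap-ˡ a b)) (swap-ʳ a b)
  ... | right         = trans (cong (swap a b) (swap-ʳ a b)) (swap-ˡ a b)
  ... | other x≢a x≢b = trans (cong (swap a b) (swap-fix x≢a x≢b)) (swap-fix x≢a x≢b)

  swap-injective : (a b : Fin m) → Injective _≡_ _≡_ (swap a b)
  swap-injective a b {x} {y} p =
    trans (sym (swap-involutive a b x)) (trans (cong (swap a b) p) (swap-involutive a b y))

  swap-comm : (a b x : Fin m) → swap a b x ≡ swap b a x
  swap-comm a b x with swapView a b x
  ... | left          = trans (swap-ˡ a b) (sym (swap-ʳ b a))
  ... | right         = trans (swap-ʳ a b) (sym (swap-ˡ b a))
  ... | other x≢a x≢b = trans (swap-fix x≢a x≢b) (sym (swap-fix x≢b x≢a))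

  swap-conj : ∀ {σ : Fin m → Fin m} → Injective _≡_ _≡_ σ →
              (a b x : Fin m) → swap (σ a) (σ b) (σ x) ≡ σ (swap a b x)
  swap-conj {σ} σ-inj a b x with swapView a b x
  ... | left          = trans (swap-ˡ (σ a) (σ b)) (cong σ (sym (swap-ˡ a b)))
  ... | right         = trans (swap-ʳ (σ a) (σ b)) (cong σ (sym (swap-ʳ a b)))
  ... | other x≢a x≢b = trans (swap-fix (x≢a ∘ σ-inj) (x≢b ∘ σ-inj)) (cong σ (sym (swap-fix x≢a x≢b)))

  swap-slide : {a b c : Fin m} (x : Fin m) → c ≢ a → c ≢ b →
               swap a c (swap a b x) ≡ swap a b (swap b c x)
  swap-slide {a} {b} {c} x c≢a c≢b = begin
    swap a c (swap a b x)                        ≡⟨ cong₂ (λ p q → swap p q (swap a b x)) (swap-ʳ a b) (swap-fix c≢a c≢b) ⟨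
    swap (swap a b b) (swap a b c) (swap a b x)  ≡⟨ swap-conj (swap-injective a b) b c x ⟩
    swap a b (swap b c x)                        ∎
    where open ≡-Reasoning

  swap-rotate : {e a g : Fin m} (x : Fin m) → g ≢ e → g ≢ a →
                swap g a (swap a e (swap e g x)) ≡ swap e a x
  swap-rotate {e} {a} {g} x g≢e g≢a = begin
    swap g a (swap a e (swap e g x))  ≡⟨ cong (swap g a) (swap-slide x g≢a g≢e) ⟨
    swap g a (swap a g (swap a e x))  ≡⟨ cong (swap g a) (swap-comm a g (swap a e x)) ⟩
    swap g a (swap g a (swap a e x))  ≡⟨ swap-involutive g a (swap a e x) ⟩
    swap a e x                        ≡⟨ swap-comm a e x ⟩
    swap e a x                        ∎
    where open ≡-Reasoning

  swap-conjugate : {e a f : Fin m} (x : Fin m) → f ≢ e → f ≢ a →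
                   swap e a (swap a f (swap e a x)) ≡ swap e f x
  swap-conjugate {e} {a} {f} x f≢e f≢a = begin
    swap e a (swap a f (swap e a x))  ≡⟨ swap-slide (swap e a x) f≢e f≢a ⟨
    swap e f (swap e a (swap e a x))  ≡⟨ cong (swap e f) (swap-involutive e a x) ⟩
    swap e f x                        ∎
    where open ≡-Reasoning

module _ {m : ℕ} {S : EdgeSet m} where

  Exch-≐-swap : ∀ {a b} → S a → ¬ S b → Exch S a b ≐ (S ∘ swap a b)
  Exch-≐-swap {a} {b} Sa ¬Sb = to , from
    where
    a≢b : a ≢ b
    a≢b a≡b = ¬Sb (subst S a≡b Sa)
    to : Exch S a b ⊆ (S ∘ swap a b)
    to {x} x∈ with swapView a b x | x∈
    ... | left          | inj₁ (_ , a≢a) = contradiction refl a≢a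
    ... | left          | inj₂ a≡b       = contradiction a≡b a≢b
    ... | right         | _              = subst S (sym (swap-ʳ a b)) Sa
    ... | other x≢a x≢b | inj₁ (Sx , _)  = subst S (sym (swap-fix x≢a x≢b)) Sx
    ... | other x≢a x≢b | inj₂ x≡b       = contradiction x≡b x≢b
    from : (S ∘ swap a b) ⊆ Exch S a b
    from {x} Sσx with swapView a b x
    ... | left          = contradiction (subst S (swap-ˡ a b) Sσx) ¬Sb
    ... | right         = inj₂ refl
    ... | other x≢a x≢b = inj₁ (subst S (swap-fix x≢a x≢b) Sσx , x≢a)

  ≐-swap : ∀ {a b} → S a → S b → S ≐ (S ∘ swap a b)
  ≐-swap {a} {b} Sa Sb = to , from
    where
    to : S ⊆ (S ∘ swap a b)
    to {x} Sx with swapView a b x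
    ... | left          = subst S (sym (swap-ˡ a b)) Sb
    ... | right         = subst S (sym (swap-ʳ a b)) Sa
    ... | other x≢a x≢b = subst S (sym (swap-fix x≢a x≢b)) Sx
    from : (S ∘ swap a b) ⊆ S
    from {x} Sσx with swapView a b x
    ... | left          = Sa
    ... | right         = Sb
    ... | other x≢a x≢b = subst S (swap-fix x≢a x≢b) Sσx

  Exch-removes : ∀ {a b} → a ≢ b → ¬ Exch S a b a
  Exch-removes _   (inj₁ (_ , a≢a)) = a≢a refl
  Exch-removes a≢b (inj₂ a≡b)       = a≢b a≡b

  Exch-inverse : ∀ {a b} → S a → ¬ S b → Exch (Exch S a b) b a ≐ S
  Exch-inverse {a} {b} Sa ¬Sb = to , from
    where
    to : Exch (Exch S a b) b a ⊆ S
    to (inj₁ (inj₁ (Sx , _) , _)) = Sx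
    to (inj₁ (inj₂ x≡b , x≢b))    = contradiction x≡b x≢b
    to (inj₂ refl)                = Sa
    from : S ⊆ Exch (Exch S a b) b a
    from {x} Sx with x ≟ a
    ... | yes x≡a = inj₂ x≡a
    ... | no x≢a  = inj₁ (inj₁ (Sx , x≢a) , λ x≡b → ¬Sb (subst S x≡b Sx))

  Exch-Exch-shift : ∀ {e a g} → S e → e ≢ a → a ≢ g → Exch (Exch S e g) a e ≐ Exch S a g
  Exch-Exch-shift {e} {a} {g} Se e≢a a≢g = to , from
    where
    to : Exch (Exch S e g) a e ⊆ Exch S a g
    to (inj₁ (inj₁ (Sx , _) , x≢a)) = inj₁ (Sx , x≢a)
    to (inj₁ (inj₂ x≡g , _))         = inj₂ x≡g
    to (inj₂ refl)                   = inj₁ (Se , e≢a)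
    from : Exch S a g ⊆ Exch (Exch S e g) a e
    from {x} (inj₁ (Sx , x≢a)) with x ≟ e
    ... | yes x≡e = inj₂ x≡e
    ... | no x≢e  = inj₁ (inj₁ (Sx , x≢e) , x≢a)
    from (inj₂ refl) = inj₁ (inj₂ refl , a≢g ∘ sym)

module _ {n m : ℕ} {G : Graph n m} where

  Reach-mono : ∀ {S T : EdgeSet m} → S ⊆ T → ∀ {u v} → Reach G S u v → Reach G T u v
  Reach-mono S⊆T here              = here
  Reach-mono S⊆T (step e Se e∼ r) = step e (S⊆T Se) e∼ (Reach-mono S⊆T r)

  SpanningTree-resp-≐ : ∀ {S T : EdgeSet m} → S ≐ T → SpanningTree G S → SpanningTree G T
  SpanningTree-resp-≐ (S⊆T , T⊆S) (connected , acyclic) =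
    (λ u v → Reach-mono S⊆T (connected u v)) ,
    (λ e Te r → acyclic e (T⊆S Te) (Reach-mono (map₁ T⊆S) r))

Labelling : ∀ {k m} → (Fin k → Fin m) → EdgeSet m → Set
Labelling L S = Injective _≡_ _≡_ L × S ≐ Img L

Labelling-resp-≐ : ∀ {k m} {L : Fin k → Fin m} {S T : EdgeSet m} →
                   S ≐ T → Labelling L S → Labelling L T
Labelling-resp-≐ S≐T (L-inj , S≐Img) = L-inj , ≐-trans (≐-sym S≐T) S≐Img

module _ {k m : ℕ} {L : Fin k → Fin m} where

  Img-swap : ∀ {a b} → Img (swap a b ∘ L) ≐ (Img L ∘ swap a b)
  Img-swap {a} {b} =
    (λ { (t , σLt≡x) → t , trans (sym (swap-involutive a b (L t))) (cong (swap a b) σLt≡x) }) ,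
    (λ { {x} (t , Lt≡σx) → t , trans (cong (swap a b) Lt≡σx) (swap-involutive a b x) })

  Labelling-∘swap : ∀ {S a b} → Labelling L S → Labelling (swap a b ∘ L) (S ∘ swap a b)
  Labelling-∘swap {a = a} {b} (L-inj , S⊆Img , Img⊆S) =
    L-inj ∘ swap-injective a b , ≐-trans (S⊆Img , Img⊆S) (≐-sym Img-swap)

  Labelling-exchange : ∀ {S a b} → Labelling L S → S a → ¬ S b →
                       Labelling (swap a b ∘ L) (Exch S a b)
  Labelling-exchange lab Sa ¬Sb = Labelling-resp-≐ (≐-sym (Exch-≐-swap Sa ¬Sb)) (Labelling-∘swap lab)

  Labelling-swap : ∀ {S a b} → Labelling L S → S a → S b → Labelling (swap a b ∘ L) S
  Labelling-swap lab Sa Sb = Labelling-resp-≐ (≐-sym (≐-swap Sa Sb)) (Labelling-∘swap lab)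

  exchange-step : ∀ {n} {G : Graph n m} {S a b} → Labelling L S → S a → ¬ S b →
                  SpanningTree G (Exch S a b) → ExStep G L (swap a b ∘ L)
  exchange-step {a = a} {b} lab@(L-inj , S⊆Img , Img⊆S) Sa ¬Sb tree
    with S⊆Img Sa
  ... | i , Li≡a =
    i , b , ¬Sb ∘ Img⊆S , trans (cong (swap a b) Li≡a) (swap-ˡ a b) , unchanged ,
    SpanningTree-resp-≐ (proj₂ (Labelling-exchange lab Sa ¬Sb)) tree
    where
    unchanged : ∀ j → j ≢ i → swap a b (L j) ≡ L j
    unchanged j j≢i =
      swap-fix (λ Lj≡a → j≢i (L-inj (trans Lj≡a (sym Li≡a)))) (λ Lj≡b → ¬Sb (Img⊆S (j , Lj≡b)))

module _ {n m k : ℕ} {G : Graph n m} where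

  ExStep-respˡ : ∀ {L M N : Fin k → Fin m} → L ≗ M → ExStep G M N → ExStep G L N
  ExStep-respˡ L≗M (i , e' , e'∉M , Ni≡e' , unchanged , tree) =
    i , e' , (λ (t , Lt≡e') → e'∉M (t , trans (sym (L≗M t)) Lt≡e')) , Ni≡e' ,
    (λ j j≢i → trans (unchanged j j≢i) (sym (L≗M j))) , tree

  ExSteps-respˡ : ∀ {s} {L M N : Fin k → Fin m} → L ≗ M → ExSteps G s M N → ExSteps G s L N
  ExSteps-respˡ L≗M (done M≗N)     = done (λ i → trans (L≗M i) (M≗N i))
  ExSteps-respˡ L≗M (more st steps) = more (ExStep-respˡ L≗M st) steps

  ExSteps-respʳ : ∀ {s} {L M N : Fin k → Fin m} → ExSteps G s L M → M ≗ N → ExSteps G s L N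
  ExSteps-respʳ (done L≗M)      M≗N = done (λ i → trans (L≗M i) (M≗N i))
  ExSteps-respʳ (more st steps) M≗N = more st (ExSteps-respʳ steps M≗N)

  ExSteps-++ : ∀ {s t} {L M N : Fin k → Fin m} →
               ExSteps G s L M → ExSteps G t M N → ExSteps G (s + t) L N
  ExSteps-++ (done L≗M)      steps′ = ExSteps-respˡ L≗M steps′
  ExSteps-++ (more st steps) steps′ = more st (ExSteps-++ steps steps′)

conjugation-cost : ∀ {s} l → s ≤ 3 * l → 3 + (s + 3) ≤ 3 * (2 + l)
conjugation-cost {s} l s≤3l = begin
  3 + (s + 3)  ≡⟨ cong (3 +_) (+-comm s 3) ⟩
  6 + s        ≤⟨ +-monoʳ-≤ 6 s≤3l ⟩
  6 + 3 * l    ≡⟨ *-distribˡ-+ 3 2 l ⟨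
  3 * (2 + l)  ∎
  where open ≤-Reasoning

module _ {n m : ℕ} (G : Graph n m) (B : EdgeSet m) where

  Hop : Fin m → Fin m → Set
  Hop e a = Σ (Fin m) λ g → ¬ B g × SpanningTree G (Exch B e g) × SpanningTree G (Exch B a g)

  ¬FAdj-tree : ∀ {e f} → B e → B f → ¬ FAdj G B e f
  ¬FAdj-tree _  Bf (inj₁ (_ , ¬Bf , _)) = ¬Bf Bf
  ¬FAdj-tree Be _  (inj₂ (_ , ¬Be , _)) = ¬Be Be

  FAdj-FAdj⇒Hop : ∀ {e g a} → B e → FAdj G B e g → FAdj G B g a → B a × Hop e a
  FAdj-FAdj⇒Hop Be (inj₂ (_ , ¬Be , _))       _                    = contradiction Be ¬Be
  FAdj-FAdj⇒Hop Be (inj₁ (_ , ¬Bg , _))       (inj₁ (Bg , _))      = contradiction Bg ¬Bg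
  FAdj-FAdj⇒Hop Be (inj₁ (_ , ¬Bg , tree-e)) (inj₂ (Ba , _ , tree-a)) = Ba , _ , ¬Bg , tree-e , tree-a

  rotate : ∀ {k} {L : Fin k → Fin m} {e a} → SpanningTree G B → Labelling L B →
           B e → B a → e ≢ a → Hop e a → ExSteps G 3 L (swap e a ∘ L)
  rotate {L = L} {e} {a} tree lab Be Ba e≢a (g , ¬Bg , tree-e , tree-a) =
    more (exchange-step lab Be ¬Bg tree-e)
      (more (exchange-step lab₁ a∈₁ e∉₁ tree₂)
        (more (exchange-step lab₂ (inj₂ refl) a∉₂ tree₃)
          (done (λ i → swap-rotate (L i) (e≢g ∘ sym) (a≢g ∘ sym)))))
    where
    e≢g : e ≢ g
    e≢g e≡g = ¬Bg (subst B e≡g Be)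
    a≢g : a ≢ g
    a≢g a≡g = ¬Bg (subst B a≡g Ba)
    a∈₁ : Exch B e g a
    a∈₁ = inj₁ (Ba , e≢a ∘ sym)
    e∉₁ : ¬ Exch B e g e
    e∉₁ = Exch-removes {S = B} e≢g
    a∉₂ : ¬ Exch B a g a
    a∉₂ = Exch-removes {S = B} a≢g
    lab₁ : Labelling (swap e g ∘ L) (Exch B e g)
    lab₁ = Labelling-exchange lab Be ¬Bg
    lab₂ : Labelling (swap a e ∘ swap e g ∘ L) (Exch B a g)
    lab₂ = Labelling-resp-≐ (Exch-Exch-shift Be e≢a a≢g) (Labelling-exchange lab₁ a∈₁ e∉₁)
    tree₂ : SpanningTree G (Exch (Exch B e g) a e)
    tree₂ = SpanningTree-resp-≐ (≐-sym (Exch-Exch-shift Be e≢a a≢g)) tree-a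
    tree₃ : SpanningTree G (Exch (Exch B a g) g a)
    tree₃ = SpanningTree-resp-≐ (≐-sym (Exch-inverse Ba ¬Bg)) tree

  FWalk⇒swap : ∀ {k l e f} → SpanningTree G B → B e → B f → FWalk G B l e f →
               (L : Fin k → Fin m) → Labelling L B →
               Σ ℕ λ s → s ≤ 3 * l × ExSteps G s L (swap e f ∘ L)
  FWalk⇒swap tree Be Bf here L lab = 0 , z≤n , done (λ i → sym (swap-self _ (L i)))
  FWalk⇒swap tree Be Bf (step adj here) L lab = contradiction adj (¬FAdj-tree Be Bf)
  FWalk⇒swap {l = suc (suc l)} {e} {f} tree Be Bf (step adj₁ (step {g = a} adj₂ walk)) L lab
    with FAdj-FAdj⇒Hop Be adj₁ adj₂ | e ≟ f | a ≟ e | a ≟ f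
  ... | _ | yes refl | _ | _ = 0 , z≤n , done (λ i → sym (swap-self e (L i)))
  ... | Ba , _ | no _ | yes refl | _ =
    let s , s≤3l , steps = FWalk⇒swap tree Ba Bf walk L lab
    in s , ≤-trans s≤3l (*-monoʳ-≤ 3 (m≤n+m l 2)) , steps
  ... | Ba , hop | no _ | no a≢e | yes refl =
    3 , *-monoʳ-≤ 3 (s≤s (z≤n {n = suc l})) , rotate tree lab Be Ba (a≢e ∘ sym) hop
  ... | Ba , hop | no e≢f | no a≢e | no a≢f =
    let s , s≤3l , steps = FWalk⇒swap tree Ba Bf walk (swap e a ∘ L) (Labelling-swap lab Be Ba)
        rotation = rotate tree lab Be Ba (a≢e ∘ sym) hop
        rotation′ = rotate tree (Labelling-swap (Labelling-swap lab Be Ba) Ba Bf) Be Ba (a≢e ∘ sym) hop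
    in 3 + (s + 3) , conjugation-cost l s≤3l ,
       ExSteps-respʳ (ExSteps-++ rotation (ExSteps-++ steps rotation′))
         (λ i → swap-conjugate (L i) (e≢f ∘ sym) (a≢f ∘ sym))

lemma1 : Σ ℕ λ C →
    ∀ {n m} (G : Graph n m) → TwoConnected G →
    (B : EdgeSet m) → SpanningTree G B →
    (d : ℕ) → Diameter G B d →
    ∀ {k} (L : Fin k → Fin m) → Injective _≡_ _≡_ L → (∀ x → B x ⇔ Img L x) →
    (e f : Fin m) → B e → B f →
    Σ ℕ λ s → s ≤ C * d × ExSteps G s L (SwapLabels L e f)
lemma1 = 3 , λ G _ B tree d (walks , _) L L-inj B⇔Img e f Be Bf →
  let l , l≤d , walk = walks e f
      lab : Labelling L B
      lab = L-inj , (λ {x} → Equivalence.to (B⇔Img x)) , (λ {x} → Equivalence.from (B⇔Img x))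
      s , s≤3l , steps = FWalk⇒swap G B tree Be Bf walk L lab
  in s , ≤-trans s≤3l (*-monoʳ-≤ 3 l≤d) , steps
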